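{- Let $(Q,f)$ be a polymatroid, let $X,Y\subseteq Q$, and let $\bar{X}=\mathrm{cl}(X)$, $\bar{Y}=\mathrm{cl}(Y)$. If $(Q,f)$ admits an AK extension for $(\bar{X},\bar{Y})$, then it admits an AK extension for $(X,Y)$.
   Context: A polymatroid is a pair $(Q,f)$ with $Q$ finite and $f:\mathcal{P}(Q)\to\mathbb{R}$ satisfying $f(\emptyset)=0$, monotonicity, and submodularity. Write $AB=A\cup B$ and $g(A|B)=g(AB)-g(B)$. The closure is $\mathrm{cl}(X)=\{x\in Q: f(X\cup\{x\})=f(X)\}$. An extension of $(Q,f)$ is a polymatroid $(QZ,g)$ with $Q\cap Z=\emptyset$ and $g=f$ on subsets of $Q$. For $X,Y\subseteq Q$, an AK (Ahlswede–Körner) extension for $(X,Y)$ is an extension $(QZ,g)$ with (AK1) $g(Z|X)=0$ and (AK2) $g(X'|Z)=g(X'|Y)$ for every $X'\subseteq X$. -}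

module Defs where

open import Level using (Level; _⊔_) renaming (suc to lsuc)
open import Data.Nat using (ℕ; _+_)
open import Data.Product using (Σ; Σ-syntax; _×_)
open import Data.Bool using (false; true)
open import Data.Vec using (replicate; _++_)
open import Data.Fin using (Fin)
open import Data.Fin.Subset using (Subset; ⊥; ⁅_⁆; _∈_; _⊆_; _∪_; _∩_)
open import Algebra.Bundles using (AbelianGroup)
open import Relation.Binary.Structures using (IsTotalOrder)
open import Function.Bundles using (_⇔_)

-- The paper uses ℝ; agda-stdlib has no
-- reals, so we work over an arbitrary totally ordered abelian group
-- (ℝ is an instance).
record OrderedAbelianGroup (c ℓ₁ ℓ₂ : Level) : Set (lsuc (c ⊔ ℓ₁ ⊔ ℓ₂)) where
  field
    abelianGroup : AbelianGroup c ℓ₁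
  open AbelianGroup abelianGroup public
  infix 4 _≤_
  field
    _≤_          : Carrier → Carrier → Set ℓ₂
    isTotalOrder : IsTotalOrder _≈_ _≤_
    +-monoˡ-≤    : ∀ z {x y} → x ≤ y → (x ∙ z) ≤ (y ∙ z)

module _ {c ℓ₁ ℓ₂ : Level} (R : OrderedAbelianGroup c ℓ₁ ℓ₂) where
  open OrderedAbelianGroup R

  _+ᴿ_ : Carrier → Carrier → Carrier
  x +ᴿ y = x ∙ y

  _-ᴿ_ : Carrier → Carrier → Carrier
  x -ᴿ y = x ∙ (y ⁻¹)

  record Polymatroid (n : ℕ) : Set (c ⊔ ℓ₁ ⊔ ℓ₂) where
    field
      rank        : Subset n → Carrier
      rank-empty  : rank ⊥ ≈ ε
      monotone    : ∀ {A B} → A ⊆ B → rank A ≤ rank B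
      submodular  : ∀ A B → (rank (A ∪ B) +ᴿ rank (A ∩ B)) ≤ (rank A +ᴿ rank B)
  open Polymatroid public

  cond : ∀ {n} → Polymatroid n → Subset n → Subset n → Carrier
  cond g A B = rank g (A ∪ B) -ᴿ rank g B

  IsClosure : ∀ {n} → Polymatroid n → Subset n → Subset n → Set (ℓ₁)
  IsClosure {n} f X C = ∀ (x : Fin n) → (x ∈ C) ⇔ (rank f (X ∪ ⁅ x ⁆) ≈ rank f X)

  -- An extension of a polymatroid on Q = Fin n lives on QZ = Fin (n + m):
  -- the first n points are Q, the last m points are the new set Z.
  lift : ∀ {n} m → Subset n → Subset (n + m)
  lift m A = A ++ replicate m false

  Zset : ∀ n m → Subset (n + m)
  Zset n m = replicate n false ++ replicate m true

  IsExtension : ∀ {n m} → Polymatroid n → Polymatroid (n + m) → Set ℓ₁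
  IsExtension {n} {m} f g = ∀ (A : Subset n) → rank g (lift m A) ≈ rank f A

  IsAKExtension : ∀ {n m} → Polymatroid n → Polymatroid (n + m)
                → Subset n → Subset n → Set ℓ₁
  IsAKExtension {n} {m} f g X Y =
    IsExtension f g
    × cond g (Zset n m) (lift m X) ≈ ε
    × (∀ (X′ : Subset n) → X′ ⊆ X →
         cond g (lift m X′) (Zset n m) ≈ cond g (lift m X′) (lift m Y))

  AdmitsAK : ∀ {n} → Polymatroid n → Subset n → Subset n → Set (c ⊔ ℓ₁ ⊔ ℓ₂)
  AdmitsAK {n} f X Y = Σ[ m ∈ ℕ ] Σ[ g ∈ Polymatroid (n + m) ] IsAKExtension f g X Y

{-# OPTIONS --safe #-}

-- Say that B spans S when f(B ∪ S) ≤ f(B).  By submodularity, spanning survives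
-- enlarging B and taking unions of spanned sets, so X spans cl(X) point by point.
-- Sets that span each other have the same conditional ranks g(A|·), and spanning
-- transfers to any extension g.  Hence X, cl(X) and Y, cl(Y) are interchangeable
-- in (AK1) and in the right-hand side of (AK2), while X ⊆ cl(X) makes (AK2) for
-- cl(X) cover every X′ ⊆ X: the AK extension for the closures serves (X, Y) as is.
module Submission where

open import Defs
open import Level using (Level)
open import Data.Nat using (ℕ; _+_)
open import Data.Bool using (false; _∨_)
open import Data.Empty using (⊥-elim)
open import Data.Fin using (_≟_)
open import Data.Fin.Subset
  using (Subset; _∈_; _⊆_; _⊂_; _∪_; _∩_; _-_; ⁅_⁆)
open import Data.Fin.Subset.Properties
  using ( ⊆-refl; ⊆-trans; ∪-assoc; p⊆p∪q; q⊆p∪q; x∈p∪q⁻; x∈p∪q⁺; x∈p∩q⁺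
        ; x∈⁅x⁆; x∈⁅y⁆⇒x≡y; nonempty?; p─q⊆p; p∩q≢∅⇒p─q⊂p; x∈p∧x≢y⇒x∈p-y )
open import Data.Fin.Subset.Induction using (⊂-wellFounded; Acc; acc)
open import Data.Product as Product using (_×_; _,_)
open import Data.Sum using (inj₁; inj₂; [_,_]′)
open import Data.Vec using (replicate; _++_)
open import Data.Vec.Properties using (zipWith-++; zipWith-replicate)
open import Function using (_∘_)
open import Function.Bundles using (Equivalence)
open import Relation.Binary.Bundles using (Poset)
open import Relation.Binary.Structures using (IsTotalOrder)
open import Relation.Binary.PropositionalEquality as ≡ using (_≡_)
open import Relation.Nullary using (yes; no)
import Algebra.Properties.AbelianGroup as AbelianGroupProperties
import Relation.Binary.Reasoning.PartialOrder as ≤-Reasoning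

∪-lub : ∀ {n} {A B C : Subset n} → A ⊆ C → B ⊆ C → A ∪ B ⊆ C
∪-lub {A = A} {B} A⊆C B⊆C x∈A∪B = [ A⊆C , B⊆C ]′ (x∈p∪q⁻ A B x∈A∪B)

∪-monoʳ-⊆ : ∀ {n} {A B C : Subset n} → B ⊆ C → A ∪ B ⊆ A ∪ C
∪-monoʳ-⊆ {A = A} {C = C} B⊆C = ∪-lub (p⊆p∪q C) (⊆-trans B⊆C (q⊆p∪q A C))

p⊆p-x∪⁅x⁆ : ∀ {n} (A : Subset n) x → A ⊆ (A - x) ∪ ⁅ x ⁆
p⊆p-x∪⁅x⁆ A x {y} y∈A with y ≟ x
... | yes ≡.refl = x∈p∪q⁺ (inj₂ (x∈⁅x⁆ x))
... | no y≢x     = x∈p∪q⁺ (inj₁ (x∈p∧x≢y⇒x∈p-y y∈A y≢x))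

module Polymatroids {c ℓ₁ ℓ₂ : Level} (R : OrderedAbelianGroup c ℓ₁ ℓ₂) where
  open OrderedAbelianGroup R hiding (_-_)
  open AbelianGroupProperties abelianGroup using (//-rightDividesʳ)
  open IsTotalOrder isTotalOrder using (isPartialOrder; antisym; ≲-respˡ-≈; ≲-respʳ-≈)
    renaming (reflexive to ≤-reflexive; trans to ≤-trans)

  poset : Poset c ℓ₁ ℓ₂
  poset = record { isPartialOrder = isPartialOrder }

  ∙-monoʳ-≤ : ∀ z {x y} → x ≤ y → z ∙ x ≤ z ∙ y
  ∙-monoʳ-≤ z {x} {y} x≤y = ≲-respˡ-≈ (comm x z) (≲-respʳ-≈ (comm y z) (+-monoˡ-≤ z x≤y))

  ∙-cancelʳ-≤ : ∀ z {x y} → x ∙ z ≤ y ∙ z → x ≤ y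
  ∙-cancelʳ-≤ z {x} {y} xz≤yz = ≲-respˡ-≈ (//-rightDividesʳ z x)
    (≲-respʳ-≈ (//-rightDividesʳ z y) (+-monoˡ-≤ (z ⁻¹) xz≤yz))

  module _ {n : ℕ} (f : Polymatroid R n) where
    open ≤-Reasoning poset

    Spans : Subset n → Subset n → Set ℓ₂
    Spans B S = rank f (B ∪ S) ≤ rank f B

    MutuallySpan : Subset n → Subset n → Set ℓ₂
    MutuallySpan B B′ = Spans B B′ × Spans B′ B

    spans-⊆ : ∀ {B S} → S ⊆ B → Spans B S
    spans-⊆ S⊆B = monotone f (∪-lub ⊆-refl S⊆B)

    spans-antitoneʳ : ∀ {B S T} → S ⊆ T → Spans B T → Spans B S
    spans-antitoneʳ S⊆T B-spans-T = ≤-trans (monotone f (∪-monoʳ-⊆ S⊆T)) B-spans-T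

    spans-monoˡ : ∀ {A B S} → B ⊆ A → Spans B S → Spans A S
    spans-monoˡ {A} {B} {S} B⊆A B-spans-S = begin
        rank f (A ∪ S)        ≤⟨ monotone f (∪-monoʳ-⊆ (q⊆p∪q B S)) ⟩
        rank f (A ∪ (B ∪ S))  ≤⟨ ∙-cancelʳ-≤ (rank f (A ∩ (B ∪ S))) submodular-bound ⟩
        rank f A              ∎
      where
      B⊆A∩BS : B ⊆ A ∩ (B ∪ S)
      B⊆A∩BS x∈B = x∈p∩q⁺ (B⊆A x∈B , p⊆p∪q S x∈B)

      submodular-bound : rank f (A ∪ (B ∪ S)) ∙ rank f (A ∩ (B ∪ S))
                       ≤ rank f A ∙ rank f (A ∩ (B ∪ S))
      submodular-bound = begin
        rank f (A ∪ (B ∪ S)) ∙ rank f (A ∩ (B ∪ S))  ≤⟨ submodular f A (B ∪ S) ⟩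
        rank f A ∙ rank f (B ∪ S)                    ≤⟨ ∙-monoʳ-≤ (rank f A) B-spans-S ⟩
        rank f A ∙ rank f B                          ≤⟨ ∙-monoʳ-≤ (rank f A) (monotone f B⊆A∩BS) ⟩
        rank f A ∙ rank f (A ∩ (B ∪ S))              ∎

    spans-∪ : ∀ {B S T} → Spans B S → Spans B T → Spans B (S ∪ T)
    spans-∪ {B} {S} {T} B-spans-S B-spans-T = begin
      rank f (B ∪ (S ∪ T))  ≡⟨ ≡.cong (rank f) (∪-assoc B S T) ⟨
      rank f ((B ∪ S) ∪ T)  ≤⟨ spans-monoˡ {B ∪ S} (p⊆p∪q S) B-spans-T ⟩
      rank f (B ∪ S)        ≤⟨ B-spans-S ⟩
      rank f B              ∎

    spans-∪ˡ : ∀ {A B S} → Spans B S → Spans (A ∪ B) (A ∪ S)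
    spans-∪ˡ {A} {B} B-spans-S =
      spans-∪ (spans-⊆ (p⊆p∪q B)) (spans-monoˡ (q⊆p∪q A B) B-spans-S)

    spans-pointwise : ∀ {B} S → (∀ {x} → x ∈ S → Spans B ⁅ x ⁆) → Spans B S
    spans-pointwise {B} S = go S (⊂-wellFounded S)
      where
      go : ∀ S → Acc _⊂_ S → (∀ {x} → x ∈ S → Spans B ⁅ x ⁆) → Spans B S
      go S (acc smaller) spans-points with nonempty? S
      ... | no S-empty = spans-⊆ (λ x∈S → ⊥-elim (S-empty (_ , x∈S)))
      ... | yes (x , x∈S) =
        spans-antitoneʳ (p⊆p-x∪⁅x⁆ S x)
          (spans-∪ (go (S - x) (smaller S-x⊂S) (spans-points ∘ p─q⊆p S ⁅ x ⁆))
                   (spans-points x∈S))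
        where
        S-x⊂S : S - x ⊂ S
        S-x⊂S = p∩q≢∅⇒p─q⊂p S ⁅ x ⁆ (x , x∈p∩q⁺ (x∈S , x∈⁅x⁆ x))

    rank-cong-mutuallySpan : ∀ {B B′} → MutuallySpan B B′ → rank f B ≈ rank f B′
    rank-cong-mutuallySpan {B} {B′} (B-spans-B′ , B′-spans-B) = antisym
      (≤-trans (monotone f (q⊆p∪q B′ B)) B′-spans-B)
      (≤-trans (monotone f (q⊆p∪q B B′)) B-spans-B′)

    cond-cong-mutuallySpan : ∀ A {B B′} → MutuallySpan B B′ →
                             cond R f A B ≈ cond R f A B′
    cond-cong-mutuallySpan A (B-spans-B′ , B′-spans-B) = ∙-cong
      (rank-cong-mutuallySpan (spans-∪ˡ B-spans-B′ , spans-∪ˡ B′-spans-B))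
      (⁻¹-cong (rank-cong-mutuallySpan (B-spans-B′ , B′-spans-B)))

    closure-extensive : ∀ {X C} → IsClosure R f X C → X ⊆ C
    closure-extensive {X} X-cl-C {x} x∈X = Equivalence.from (X-cl-C x) (antisym
      (spans-⊆ (λ y∈⁅x⁆ → ≡.subst (_∈ X) (≡.sym (x∈⁅y⁆⇒x≡y x y∈⁅x⁆)) x∈X))
      (monotone f (p⊆p∪q ⁅ x ⁆)))

    closure-mutuallySpan : ∀ {X C} → IsClosure R f X C → MutuallySpan X C
    closure-mutuallySpan {C = C} X-cl-C =
      spans-pointwise C (λ {x} x∈C → ≤-reflexive (Equivalence.to (X-cl-C x) x∈C)) ,
      spans-⊆ (closure-extensive X-cl-C)

  lift-∪ : ∀ {n} m (A B : Subset n) → lift R m A ∪ lift R m B ≡ lift R m (A ∪ B)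
  lift-∪ m A B = ≡.trans (zipWith-++ _∨_ A _ B _)
    (≡.cong ((A ∪ B) ++_) (zipWith-replicate _∨_ false false))

  module _ {n m : ℕ} {f : Polymatroid R n} {g : Polymatroid R (n + m)} where
    open ≤-Reasoning poset

    spans-lift : IsExtension R f g → ∀ {B S} →
                 Spans f B S → Spans g (lift R m B) (lift R m S)
    spans-lift extends {B} {S} B-spans-S = begin
      rank g (lift R m B ∪ lift R m S)  ≡⟨ ≡.cong (rank g) (lift-∪ m B S) ⟩
      rank g (lift R m (B ∪ S))         ≈⟨ extends (B ∪ S) ⟩
      rank f (B ∪ S)                    ≤⟨ B-spans-S ⟩
      rank f B                          ≈⟨ extends B ⟨
      rank g (lift R m B)               ∎

    mutuallySpan-lift : IsExtension R f g → ∀ {B B′} →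
                        MutuallySpan f B B′ → MutuallySpan g (lift R m B) (lift R m B′)
    mutuallySpan-lift extends = Product.map (spans-lift extends) (spans-lift extends)

    isAKExtension-transfer : ∀ {X X̄ Y Ȳ} → X ⊆ X̄ → MutuallySpan f X X̄ → MutuallySpan f Y Ȳ →
                             IsAKExtension R f g X̄ Ȳ → IsAKExtension R f g X Y
    isAKExtension-transfer {X} {X̄} {Y} X⊆X̄ X∼X̄ Y∼Ȳ (extends , AK1-X̄ , AK2-X̄Ȳ) =
      extends , AK1-X , AK2-XY
      where
      Z = Zset R n m

      AK1-X : cond R g Z (lift R m X) ≈ ε
      AK1-X = trans (cond-cong-mutuallySpan g Z (mutuallySpan-lift extends X∼X̄)) AK1-X̄

      AK2-XY : ∀ X′ → X′ ⊆ X → cond R g (lift R m X′) Z ≈ cond R g (lift R m X′) (lift R m Y)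
      AK2-XY X′ X′⊆X = trans (AK2-X̄Ȳ X′ (X⊆X̄ ∘ X′⊆X))
        (sym (cond-cong-mutuallySpan g (lift R m X′) (mutuallySpan-lift extends Y∼Ȳ)))

proposition4p5 : ∀ {c ℓ₁ ℓ₂ : Level} (R : OrderedAbelianGroup c ℓ₁ ℓ₂) {n : ℕ}
    (f : Polymatroid R n) (X Y X̄ Ȳ : Subset n) →
    IsClosure R f X X̄ → IsClosure R f Y Ȳ →
    AdmitsAK R f X̄ Ȳ → AdmitsAK R f X Y
proposition4p5 R f X Y X̄ Ȳ X-cl-X̄ Y-cl-Ȳ (m , g , ak) =
  m , g , isAKExtension-transfer {f = f} {g} (closure-extensive f X-cl-X̄)
            (closure-mutuallySpan f X-cl-X̄) (closure-mutuallySpan f Y-cl-Ȳ) ak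
  where open Polymatroids R
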